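{- Let $\mathbb{F}_q$ be a finite field, let $k,m\ge 2$ and $n\ge 5$ be integers with $\operatorname{char}(\mathbb{F}_q)\nmid mk$, $n<mk$ and $\gcd(m,q-1)=1$, and let $a,b,a_1,\dots,a_n\in\mathbb{F}_q^*$. If $q>22^2(2mk)^{2n-2}$, then the equation $$(a_1X_1^m+\cdots+a_nX_n^m+a)^k=bX_1\cdots X_n$$ has at least one solution in $(\mathbb{F}_q^*)^n$. -}

module Defs where

open import Level using (Level; _⊔_; suc)
open import Algebra.Bundles using (CommutativeRing; Semiring)
open import Data.Nat.Base as ℕ using (ℕ; _<_; _≤_)
open import Data.Fin.Base using (Fin)
open import Data.Product.Base using (Σ; ∃; _×_)
open import Relation.Binary.PropositionalEquality using (_≡_)
open import Relation.Nullary.Negation using (¬_)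

record Field (c ℓ : Level) : Set (suc (c ⊔ ℓ)) where
  field
    commutativeRing : CommutativeRing c ℓ
  open CommutativeRing commutativeRing public
  field
    0≉1     : ¬ (0# ≈ 1#)
    inverse : ∀ x → ¬ (x ≈ 0#) → ∃ λ y → x * y ≈ 1#

  open import Algebra.Definitions.RawSemiring (Semiring.rawSemiring semiring) public
    using (_^_; sum; product) renaming (_×_ to _·_)

record FiniteField (c ℓ : Level) (q : ℕ) : Set (suc (c ⊔ ℓ)) where
  field
    field′ : Field c ℓ
  open Field field′ public
  field
    enum       : Fin q → Carrier
    enum-inj   : ∀ i j → enum i ≈ enum j → i ≡ j
    enum-surj  : ∀ x → ∃ λ i → enum i ≈ x

IsCharacteristic : ∀ {c ℓ} → Field c ℓ → ℕ → Set ℓ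
IsCharacteristic F p =
  (0 < p) × (p · 1# ≈ 0#) × (∀ d → 0 < d → d · 1# ≈ 0# → p ≤ d)
  where open Field F

{-# OPTIONS --safe #-}
module Submission where

-- Since gcd(m, q − 1) = 1 and x^(q−1) = 1 on F*, Bézout's identity makes every nonzero
-- element an m-th power. So there are nonzero ρ, σ, τ, c with
--   a₁ + a₂ ρ^m = 0,   a₃ + a₄ σ^m + a₅ τ^m = 0,   K := (a₆ + ⋯ + aₙ) c^m + a ≠ 0
-- (choosing σ and c needs an element other than 0 and 1, i.e. q ≥ 3). For every t ≠ 0 the
-- point (t⁻¹, t⁻¹ρ, t, tσ, tτ, c, …, c) makes the left-hand side K^k, while the right-hand
-- side b t ρ σ τ c^(n−5) is linear in t; solving for t gives a solution.

open import Defs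
open import Level using (Level)
import Data.Nat.Base as ℕ
import Data.Nat.Properties as ℕ
open import Data.Nat.GCD using (gcd; module Bézout)
open import Data.Nat.Coprimality using (gcd≡1⇒coprime; coprime-Bézout)
open import Data.Fin.Base using (Fin; zero; suc; punchIn; punchOut)
import Data.Fin.Properties as Fin
open import Data.Fin.Permutation using (Permutation; permutation)
open import Data.Product.Base using (∃; _×_; _,_; proj₁; proj₂)
open import Data.Maybe.Base using (nothing)
open import Data.Vec.Functional using (_∷_; replicate; drop)
import Relation.Binary.PropositionalEquality as ≡
open import Relation.Binary.Definitions using (Decidable)
open import Relation.Nullary using (yes; no)
open import Relation.Nullary.Negation using (¬_)
open import Tactic.RingSolver.Core.AlmostCommutativeRing using (fromCommutativeRing)

module FieldProperties {c ℓ} (F : Field c ℓ) where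
  open Field F hiding (zero)
  open import Relation.Binary.Reasoning.Setoid setoid
  open import Algebra.Properties.Ring ring using (-‿involutive; -0#≈0#)

  1≉0 : 1# ≉ 0#
  1≉0 1≈0 = 0≉1 (sym 1≈0)

  inv : ∀ x → x ≉ 0# → Carrier
  inv x x≉0 = proj₁ (inverse x x≉0)

  *-inverseʳ : ∀ x x≉0 → x * inv x x≉0 ≈ 1#
  *-inverseʳ x x≉0 = proj₂ (inverse x x≉0)

  *-inverseˡ : ∀ x x≉0 → inv x x≉0 * x ≈ 1#
  *-inverseˡ x x≉0 = trans (*-comm _ _) (*-inverseʳ x x≉0)

  inv-≉0 : ∀ x x≉0 → inv x x≉0 ≉ 0#
  inv-≉0 x x≉0 inv≈0 = 0≉1 (begin
    0#            ≈⟨ zeroʳ x ⟨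
    x * 0#        ≈⟨ *-congˡ inv≈0 ⟨
    x * inv x x≉0 ≈⟨ *-inverseʳ x x≉0 ⟩
    1#            ∎)

  *-cancelˡ : ∀ {x} y z → x ≉ 0# → x * y ≈ x * z → y ≈ z
  *-cancelˡ {x} y z x≉0 xy≈xz = begin
    y                   ≈⟨ *-identityˡ y ⟨
    1# * y              ≈⟨ *-congʳ (*-inverseˡ x x≉0) ⟨
    inv x x≉0 * x * y   ≈⟨ *-assoc _ x y ⟩
    inv x x≉0 * (x * y) ≈⟨ *-congˡ xy≈xz ⟩
    inv x x≉0 * (x * z) ≈⟨ *-assoc _ x z ⟨
    inv x x≉0 * x * z   ≈⟨ *-congʳ (*-inverseˡ x x≉0) ⟩
    1# * z              ≈⟨ *-identityˡ z ⟩
    z                   ∎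

  *-≉0 : ∀ {x y} → x ≉ 0# → y ≉ 0# → x * y ≉ 0#
  *-≉0 {x} {y} x≉0 y≉0 xy≈0 = y≉0 (*-cancelˡ y 0# x≉0 (trans xy≈0 (sym (zeroʳ x))))

  ^-≉0 : ∀ {x} n → x ≉ 0# → x ^ n ≉ 0#
  ^-≉0 ℕ.zero    x≉0 = 1≉0
  ^-≉0 (ℕ.suc n) x≉0 = *-≉0 x≉0 (^-≉0 n x≉0)

  -‿≉0 : ∀ {x} → x ≉ 0# → - x ≉ 0#
  -‿≉0 {x} x≉0 -x≈0 = x≉0 (begin
    x     ≈⟨ -‿involutive x ⟨
    - - x ≈⟨ -‿cong -x≈0 ⟩
    - 0#  ≈⟨ -0#≈0# ⟩
    0#    ∎)

  product-≉0 : ∀ n {f : Fin n → Carrier} → (∀ i → f i ≉ 0#) → product f ≉ 0#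
  product-≉0 ℕ.zero    f≉0 = 1≉0
  product-≉0 (ℕ.suc n) f≉0 = *-≉0 (f≉0 zero) (product-≉0 n (λ i → f≉0 (suc i)))

  1^n≈1 : ∀ n → 1# ^ n ≈ 1#
  1^n≈1 ℕ.zero    = refl
  1^n≈1 (ℕ.suc n) = trans (*-identityˡ _) (1^n≈1 n)

module FiniteFieldProperties {c ℓ q} (F : FiniteField c ℓ (ℕ.suc q)) where
  open FiniteField F hiding (zero)
  open FieldProperties field′
  open import Relation.Binary.Reasoning.Setoid setoid
  open import Algebra.Properties.Monoid.Sum *-monoid using (sum-replicate; sum-cong-≋)
  open import Algebra.Properties.CommutativeMonoid.Sum *-commutativeMonoid
    using (∑-distrib-+; ∑-permute)

  index : Carrier → Fin (ℕ.suc q)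
  index x = proj₁ (enum-surj x)

  enum-index : ∀ x → enum (index x) ≈ x
  enum-index x = proj₂ (enum-surj x)

  _≟_ : Decidable _≈_
  x ≟ y with index x Fin.≟ index y
  ... | yes i≡j = yes (begin
    x              ≈⟨ enum-index x ⟨
    enum (index x) ≡⟨ ≡.cong enum i≡j ⟩
    enum (index y) ≈⟨ enum-index y ⟩
    y              ∎)
  ... | no i≢j = no (λ x≈y → i≢j (enum-inj _ _ (begin
    enum (index x) ≈⟨ enum-index x ⟩
    x              ≈⟨ x≈y ⟩
    y              ≈⟨ enum-index y ⟨
    enum (index y) ∎)))

  unit : Fin q → Carrier
  unit j = enum (punchIn (index 0#) j)

  unit-≉0 : ∀ j → unit j ≉ 0#
  unit-≉0 j unit≈0 =
    Fin.punchInᵢ≢i (index 0#) j (enum-inj _ _ (trans unit≈0 (sym (enum-index 0#))))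

  unit-injective : ∀ i j → unit i ≈ unit j → i ≡.≡ j
  unit-injective i j uᵢ≈uⱼ = Fin.punchIn-injective (index 0#) i j (enum-inj _ _ uᵢ≈uⱼ)

  private
    index-≢0 : ∀ {y} → y ≉ 0# → index 0# ≡.≢ index y
    index-≢0 {y} y≉0 i≡j = y≉0 (begin
      y               ≈⟨ enum-index y ⟨
      enum (index y)  ≡⟨ ≡.cong enum i≡j ⟨
      enum (index 0#) ≈⟨ enum-index 0# ⟩
      0#              ∎)

  unitIndex : ∀ y → y ≉ 0# → Fin q
  unitIndex y y≉0 = punchOut (index-≢0 y≉0)

  unit-unitIndex : ∀ y y≉0 → unit (unitIndex y y≉0) ≈ y
  unit-unitIndex y y≉0 =
    trans (reflexive (≡.cong enum (Fin.punchIn-punchOut (index-≢0 y≉0)))) (enum-index y)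

  scaleIndex : ∀ x → x ≉ 0# → Fin q → Fin q
  scaleIndex x x≉0 j = unitIndex (x * unit j) (*-≉0 x≉0 (unit-≉0 j))

  unit-scaleIndex : ∀ x x≉0 j → unit (scaleIndex x x≉0 j) ≈ x * unit j
  unit-scaleIndex x x≉0 j = unit-unitIndex (x * unit j) (*-≉0 x≉0 (unit-≉0 j))

  scaleIndex-inverse : ∀ {x y} x≉0 y≉0 → x * y ≈ 1# →
                       ∀ j → scaleIndex x x≉0 (scaleIndex y y≉0 j) ≡.≡ j
  scaleIndex-inverse {x} {y} x≉0 y≉0 xy≈1 j = unit-injective _ _ (begin
    unit (scaleIndex x x≉0 (scaleIndex y y≉0 j)) ≈⟨ unit-scaleIndex x x≉0 _ ⟩
    x * unit (scaleIndex y y≉0 j)                ≈⟨ *-congˡ (unit-scaleIndex y y≉0 j) ⟩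
    x * (y * unit j)                             ≈⟨ *-assoc x y _ ⟨
    x * y * unit j                               ≈⟨ *-congʳ xy≈1 ⟩
    1# * unit j                                  ≈⟨ *-identityˡ _ ⟩
    unit j                                       ∎)

  scalePermutation : ∀ x → x ≉ 0# → Permutation q q
  scalePermutation x x≉0 = permutation (scaleIndex x x≉0) (scaleIndex x⁻¹ x⁻¹≉0)
    (scaleIndex-inverse x≉0 x⁻¹≉0 (*-inverseʳ x x≉0))
    (scaleIndex-inverse x⁻¹≉0 x≉0 (*-inverseˡ x x≉0))
    where
    x⁻¹ = inv x x≉0
    x⁻¹≉0 = inv-≉0 x x≉0

  -- Multiplication by x permutes the units, so it leaves their product P unchanged: P = x^q P.
  fermat : ∀ {x} → x ≉ 0# → x ^ q ≈ 1#
  fermat {x} x≉0 = *-cancelˡ (x ^ q) 1# (product-≉0 q unit-≉0) (begin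
    P * x ^ q                                 ≈⟨ *-comm P _ ⟩
    x ^ q * P                                 ≈⟨ *-congʳ (sum-replicate q) ⟨
    product (replicate q x) * P               ≈⟨ ∑-distrib-+ (replicate q x) unit ⟨
    product (λ j → x * unit j)                ≈⟨ sum-cong-≋ (unit-scaleIndex x x≉0) ⟨
    product (λ j → unit (scaleIndex x x≉0 j)) ≈⟨ ∑-permute unit (scalePermutation x x≉0) ⟨
    P                                         ≈⟨ *-identityʳ P ⟨
    P * 1#                                    ∎)
    where
    P = product unit

  ∃≉0,1 : 2 ℕ.≤ q → ∃ λ w → w ≉ 0# × w ≉ 1#
  ∃≉0,1 (ℕ.s≤s (ℕ.s≤s _)) = unit j , unit-≉0 j , λ w≈1 →
    Fin.punchInᵢ≢i (unitIndex 1# 1≉0) zero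
      (unit-injective _ _ (trans w≈1 (sym (unit-unitIndex 1# 1≉0))))
    where
    j = punchIn (unitIndex 1# 1≉0) zero

module DiagonalEquation {c ℓ q} (F : FiniteField c ℓ (ℕ.suc q)) (m : ℕ.ℕ)
                        (gcd[m,q]≡1 : gcd m q ≡.≡ 1) where
  open FiniteField F hiding (zero)
  open FieldProperties field′
  open FiniteFieldProperties F using (_≟_; fermat; ∃≉0,1)
  open import Relation.Binary.Reasoning.Setoid setoid
  open import Algebra.Properties.Ring ring using (+-cancelʳ)
  open import Algebra.Properties.Semiring.Exp semiring using (^-assocʳ; ^-congˡ; ^-congʳ)
  open import Algebra.Properties.CommutativeSemiring.Exp commutativeSemiring using (^-distrib-*)
  open import Algebra.Properties.Semiring.Sum semiring using (*-distribʳ-sum)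
  open import Algebra.Properties.Monoid.Sum *-monoid using (sum-replicate)
  open import Algebra.Properties.CommutativeSemigroup *-commutativeSemigroup using (x∙yz≈y∙xz)
  open import Tactic.RingSolver.NonReflective (fromCommutativeRing commutativeRing (λ _ → nothing))
    using (solve; _⊜_; _⊕_; _⊗_)

  IsSolution : ∀ {n} → ℕ.ℕ → Carrier → Carrier → (Fin n → Carrier) → (Fin n → Carrier) → Set ℓ
  IsSolution k a b as x =
    (∀ i → x i ≉ 0#) × (sum (λ i → as i * x i ^ m) + a) ^ k ≈ b * product x

  x^[y*q]≈1 : ∀ {x} → x ≉ 0# → ∀ y → x ^ (y ℕ.* q) ≈ 1#
  x^[y*q]≈1 {x} x≉0 y = begin
    x ^ (y ℕ.* q) ≈⟨ ^-congʳ x (ℕ.*-comm y q) ⟩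
    x ^ (q ℕ.* y) ≈⟨ ^-assocʳ x q y ⟨
    (x ^ q) ^ y   ≈⟨ ^-congˡ y (fermat x≉0) ⟩
    1# ^ y        ≈⟨ 1^n≈1 y ⟩
    1#            ∎

  -- Bézout gives x m = 1 + y q, making w^x an m-th root of w, or x m + 1 = y q,
  -- making (w⁻¹)^x one.
  ∃-root : ∀ {w} → w ≉ 0# → ∃ λ r → r ≉ 0# × r ^ m ≈ w
  ∃-root {w} w≉0 with coprime-Bézout (gcd≡1⇒coprime gcd[m,q]≡1)
  ... | Bézout.+- x y 1+yq≡xm = w ^ x , ^-≉0 x w≉0 , (begin
    (w ^ x) ^ m       ≈⟨ ^-assocʳ w x m ⟩
    w ^ (x ℕ.* m)     ≈⟨ ^-congʳ w 1+yq≡xm ⟨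
    w * w ^ (y ℕ.* q) ≈⟨ *-congˡ (x^[y*q]≈1 w≉0 y) ⟩
    w * 1#            ≈⟨ *-identityʳ w ⟩
    w                 ∎)
  ... | Bézout.-+ x y 1+xm≡yq = w⁻¹ ^ x , ^-≉0 x w⁻¹≉0 , *-cancelˡ _ w w⁻¹≉0 (begin
    w⁻¹ * (w⁻¹ ^ x) ^ m   ≈⟨ *-congˡ (^-assocʳ w⁻¹ x m) ⟩
    w⁻¹ * w⁻¹ ^ (x ℕ.* m) ≈⟨ ^-congʳ w⁻¹ 1+xm≡yq ⟩
    w⁻¹ ^ (y ℕ.* q)       ≈⟨ x^[y*q]≈1 w⁻¹≉0 y ⟩
    1#                    ≈⟨ *-inverseˡ w w≉0 ⟨
    w⁻¹ * w               ∎)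
    where
    w⁻¹ = inv w w≉0
    w⁻¹≉0 = inv-≉0 w w≉0

  ∃-root-binomial : ∀ {u v} → u ≉ 0# → v ≉ 0# → ∃ λ y → y ≉ 0# × v * y ^ m + u ≈ 0#
  ∃-root-binomial {u} {v} u≉0 v≉0 with ∃-root (*-≉0 (-‿≉0 u≉0) (inv-≉0 v v≉0))
  ... | y , y≉0 , yᵐ≈-u/v = y , y≉0 , (begin
    v * y ^ m + u       ≈⟨ +-congʳ (*-congˡ yᵐ≈-u/v) ⟩
    v * (- u * v⁻¹) + u ≈⟨ +-congʳ (x∙yz≈y∙xz v (- u) v⁻¹) ⟩
    - u * (v * v⁻¹) + u ≈⟨ +-congʳ (*-congˡ (*-inverseʳ v v≉0)) ⟩
    - u * 1# + u        ≈⟨ +-congʳ (*-identityʳ (- u)) ⟩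
    - u + u             ≈⟨ -‿inverseˡ u ⟩
    0#                  ∎)
    where
    v⁻¹ = inv v v≉0

  -- If s + a ≠ 0 take y = 1; otherwise s y^m + a = 0 would force y^m = 1, so let y^m ∉ {0, 1}.
  ∃-nonroot : 2 ℕ.≤ q → ∀ s {a} → a ≉ 0# → ∃ λ y → y ≉ 0# × s * y ^ m + a ≉ 0#
  ∃-nonroot 2≤q s {a} a≉0 with (s + a) ≟ 0#
  ... | no s+a≉0 = 1# , 1≉0 , λ s1ᵐ+a≈0 → s+a≉0 (trans (+-congʳ s≈s1ᵐ) s1ᵐ+a≈0)
    where
    s≈s1ᵐ : s ≈ s * 1# ^ m
    s≈s1ᵐ = sym (trans (*-congˡ (1^n≈1 m)) (*-identityʳ s))
  ... | yes s+a≈0 with ∃≉0,1 2≤q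
  ... | w , w≉0 , w≉1 with ∃-root w≉0
  ... | y , y≉0 , yᵐ≈w = y , y≉0 , λ syᵐ+a≈0 → w≉1 (*-cancelˡ w 1# s≉0 (+-cancelʳ a _ _ (begin
    s * w + a       ≈⟨ +-congʳ (*-congˡ yᵐ≈w) ⟨
    s * y ^ m + a   ≈⟨ syᵐ+a≈0 ⟩
    0#              ≈⟨ s+a≈0 ⟨
    s + a           ≈⟨ +-congʳ (*-identityʳ s) ⟨
    s * 1# + a      ∎)))
    where
    s≉0 : s ≉ 0#
    s≉0 s≈0 = a≉0 (begin
      a      ≈⟨ +-identityˡ a ⟨
      0# + a ≈⟨ +-congʳ s≈0 ⟨
      s + a  ≈⟨ s+a≈0 ⟩
      0#     ∎)

  binomial-homogeneous : ∀ u v y t → u * t ^ m + v * (t * y) ^ m ≈ (v * y ^ m + u) * t ^ m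
  binomial-homogeneous u v y t = begin
    u * t ^ m + v * (t * y) ^ m     ≈⟨ +-congˡ (*-congˡ (^-distrib-* t y m)) ⟩
    u * t ^ m + v * (t ^ m * y ^ m)
      ≈⟨ solve 4 (λ u v tᵐ yᵐ → u ⊗ tᵐ ⊕ v ⊗ (tᵐ ⊗ yᵐ) ⊜ (v ⊗ yᵐ ⊕ u) ⊗ tᵐ) refl u v (t ^ m) (y ^ m) ⟩
    (v * y ^ m + u) * t ^ m         ∎

  binomial-vanishes : ∀ {u v y} → v * y ^ m + u ≈ 0# → ∀ t → u * t ^ m + v * (t * y) ^ m ≈ 0#
  binomial-vanishes {u} {v} {y} vyᵐ+u≈0 t = begin
    u * t ^ m + v * (t * y) ^ m ≈⟨ binomial-homogeneous u v y t ⟩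
    (v * y ^ m + u) * t ^ m     ≈⟨ *-congʳ vyᵐ+u≈0 ⟩
    0# * t ^ m                  ≈⟨ zeroˡ (t ^ m) ⟩
    0#                          ∎

  scaledPoint : ∀ n (ρ σ τ c u t : Carrier) → Fin (5 ℕ.+ n) → Carrier
  scaledPoint n ρ σ τ c u t = u ∷ u * ρ ∷ t ∷ t * σ ∷ t * τ ∷ replicate n c

  scaledPoint-≉0 : ∀ {n ρ σ τ c u t} → ρ ≉ 0# → σ ≉ 0# → τ ≉ 0# → c ≉ 0# → u ≉ 0# → t ≉ 0# →
                   ∀ i → scaledPoint n ρ σ τ c u t i ≉ 0#
  scaledPoint-≉0 ρ≉0 σ≉0 τ≉0 c≉0 u≉0 t≉0 zero                                = u≉0
  scaledPoint-≉0 ρ≉0 σ≉0 τ≉0 c≉0 u≉0 t≉0 (suc zero)                          = *-≉0 u≉0 ρ≉0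
  scaledPoint-≉0 ρ≉0 σ≉0 τ≉0 c≉0 u≉0 t≉0 (suc (suc zero))                    = t≉0
  scaledPoint-≉0 ρ≉0 σ≉0 τ≉0 c≉0 u≉0 t≉0 (suc (suc (suc zero)))              = *-≉0 t≉0 σ≉0
  scaledPoint-≉0 ρ≉0 σ≉0 τ≉0 c≉0 u≉0 t≉0 (suc (suc (suc (suc zero))))        = *-≉0 t≉0 τ≉0
  scaledPoint-≉0 ρ≉0 σ≉0 τ≉0 c≉0 u≉0 t≉0 (suc (suc (suc (suc (suc _)))))     = c≉0

  form-scaledPoint : ∀ {A₀ A₁ A₂ A₃ A₄ ρ σ τ c n} (rest : Fin n → Carrier) →
    A₁ * ρ ^ m + A₀ ≈ 0# → A₄ * τ ^ m + (A₃ * σ ^ m + A₂) ≈ 0# → ∀ a u t →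
    sum (λ i → (A₀ ∷ A₁ ∷ A₂ ∷ A₃ ∷ A₄ ∷ rest) i * scaledPoint n ρ σ τ c u t i ^ m) + a
      ≈ sum rest * c ^ m + a
  form-scaledPoint {A₀} {A₁} {A₂} {A₃} {A₄} {ρ} {σ} {τ} {c} rest pair triple a u t = begin
    (P₀ + (P₁ + (P₂ + (P₃ + (P₄ + R))))) + a
      ≈⟨ solve 7 (λ P₀ P₁ P₂ P₃ P₄ R a → (P₀ ⊕ (P₁ ⊕ (P₂ ⊕ (P₃ ⊕ (P₄ ⊕ R))))) ⊕ a
                                          ⊜ ((P₀ ⊕ P₁) ⊕ ((P₂ ⊕ P₃ ⊕ P₄) ⊕ (R ⊕ a))))
                 refl P₀ P₁ P₂ P₃ P₄ R a ⟩
    (P₀ + P₁) + ((P₂ + P₃ + P₄) + (R + a))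
      ≈⟨ +-cong (binomial-vanishes pair u) (+-congʳ triple-vanishes) ⟩
    0# + (0# + (R + a))  ≈⟨ trans (+-identityˡ _) (+-identityˡ _) ⟩
    R + a                ≈⟨ +-congʳ (*-distribʳ-sum (c ^ m) rest) ⟨
    sum rest * c ^ m + a ∎
    where
    P₀ = A₀ * u ^ m
    P₁ = A₁ * (u * ρ) ^ m
    P₂ = A₂ * t ^ m
    P₃ = A₃ * (t * σ) ^ m
    P₄ = A₄ * (t * τ) ^ m
    R = sum (λ j → rest j * c ^ m)
    triple-vanishes : P₂ + P₃ + P₄ ≈ 0#
    triple-vanishes = trans (+-congʳ (binomial-homogeneous A₂ A₃ σ t)) (binomial-vanishes triple t)

  product-scaledPoint : ∀ {n} ρ σ τ c {u t} → u * t ≈ 1# →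
                        product (scaledPoint n ρ σ τ c u t) ≈ t * (ρ * (σ * (τ * c ^ n)))
  product-scaledPoint {n} ρ σ τ c {u} {t} ut≈1 = begin
    u * (u * ρ * (t * (t * σ * (t * τ * Cⁿ))))
      ≈⟨ solve-* 6 (λ u t ρ σ τ Cⁿ → u ∙ ((u ∙ ρ) ∙ (t ∙ ((t ∙ σ) ∙ ((t ∙ τ) ∙ Cⁿ))))
                                      ≐ (u ∙ t) ∙ ((u ∙ t) ∙ (t ∙ (ρ ∙ (σ ∙ (τ ∙ Cⁿ))))))
                   refl u t ρ σ τ Cⁿ ⟩
    (u * t) * ((u * t) * (t * (ρ * (σ * (τ * Cⁿ)))))
      ≈⟨ *-cong ut≈1 (*-congʳ ut≈1) ⟩
    1# * (1# * (t * (ρ * (σ * (τ * Cⁿ))))) ≈⟨ trans (*-identityˡ _) (*-identityˡ _) ⟩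
    t * (ρ * (σ * (τ * Cⁿ)))               ≈⟨ *-congˡ (*-congˡ (*-congˡ (*-congˡ (sum-replicate n)))) ⟩
    t * (ρ * (σ * (τ * c ^ n)))            ∎
    where
    open import Algebra.Solver.CommutativeMonoid *-commutativeMonoid
      using () renaming (solve to solve-*; _⊕_ to _∙_; _⊜_ to _≐_)
    Cⁿ = product (replicate n c)

  solvable : 2 ℕ.≤ q → ∀ k n → 5 ℕ.≤ n → (a b : Carrier) (as : Fin n → Carrier) →
             a ≉ 0# → b ≉ 0# → (∀ i → as i ≉ 0#) → ∃ (IsSolution k a b as)
  solvable 2≤q k _ (ℕ.s≤s (ℕ.s≤s (ℕ.s≤s (ℕ.s≤s (ℕ.s≤s {n = n} _))))) a b as a≉0 b≉0 as≉0
    with ∃-root-binomial (as≉0 zero) (as≉0 (suc zero))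
       | ∃-nonroot 2≤q (as (suc (suc (suc zero)))) (as≉0 (suc (suc zero)))
       | ∃-nonroot 2≤q (sum (drop 5 as)) a≉0
  ... | ρ , ρ≉0 , pair | σ , σ≉0 , D≉0 | c , c≉0 , K≉0
    with ∃-root-binomial D≉0 (as≉0 (suc (suc (suc (suc zero)))))
  ... | τ , τ≉0 , triple = x , scaledPoint-≉0 ρ≉0 σ≉0 τ≉0 c≉0 (inv-≉0 t t≉0) t≉0 , (begin
    (sum (λ i → as i * x i ^ m) + a) ^ k
      ≈⟨ ^-congˡ k (form-scaledPoint (drop 5 as) pair triple a t⁻¹ t) ⟩
    K ^ k                                ≈⟨ *-identityʳ (K ^ k) ⟨
    K ^ k * 1#                           ≈⟨ *-congˡ (*-inverseˡ (b * C) bC≉0) ⟨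
    K ^ k * (inv (b * C) bC≉0 * (b * C)) ≈⟨ *-assoc (K ^ k) _ (b * C) ⟨
    t * (b * C)                          ≈⟨ x∙yz≈y∙xz t b C ⟩
    b * (t * C)
      ≈⟨ *-congˡ (product-scaledPoint {n} ρ σ τ c (*-inverseˡ t t≉0)) ⟨
    b * product x                        ∎)
    where
    K C t : Carrier
    K = sum (drop 5 as) * c ^ m + a
    C = ρ * (σ * (τ * c ^ n))
    bC≉0 : b * C ≉ 0#
    bC≉0 = *-≉0 b≉0 (*-≉0 ρ≉0 (*-≉0 σ≉0 (*-≉0 τ≉0 (^-≉0 n c≉0))))
    t = K ^ k * inv (b * C) bC≉0
    t≉0 : t ≉ 0#
    t≉0 = *-≉0 (^-≉0 k K≉0) (inv-≉0 (b * C) bC≉0)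
    t⁻¹ = inv t t≉0
    x = scaledPoint n ρ σ τ c t⁻¹ t


open import Data.Nat.Base using (ℕ; _≤_; _<_; _*_; _^_; _∸_)
open import Data.Nat.Divisibility using (_∣_)
open import Relation.Binary.PropositionalEquality using (_≡_)

proposition4p5 : ∀ {c ℓ : Level} (q : ℕ) (F : FiniteField c ℓ q) (k m n : ℕ)
    → 2 ≤ k → 2 ≤ m → 5 ≤ n
    → (∀ p → IsCharacteristic (FiniteField.field′ F) p → ¬ (p ∣ m * k))
    → n < m * k
    → gcd m (q ∸ 1) ≡ 1
    → (a b : FiniteField.Carrier F) (as : Fin n → FiniteField.Carrier F)
    → ¬ (FiniteField._≈_ F a (FiniteField.0# F))
    → ¬ (FiniteField._≈_ F b (FiniteField.0# F))
    → (∀ i → ¬ (FiniteField._≈_ F (as i) (FiniteField.0# F)))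
    → 22 ^ 2 * (2 * m * k) ^ (2 * n ∸ 2) < q
    → ∃ λ (x : Fin n → FiniteField.Carrier F)
        → (∀ i → ¬ (FiniteField._≈_ F (x i) (FiniteField.0# F)))
        × FiniteField._≈_ F
            (FiniteField._^_ F (FiniteField._+_ F (FiniteField.sum F (λ i → FiniteField._*_ F (as i) (FiniteField._^_ F (x i) m))) a) k)
            (FiniteField._*_ F b (FiniteField.product F x))
proposition4p5 ℕ.zero _ _ _ _ _ _ _ _ _ _ _ _ _ _ _ _ ()
proposition4p5 (ℕ.suc q) F k m n (ℕ.s≤s (ℕ.s≤s _)) (ℕ.s≤s (ℕ.s≤s _)) 5≤n _ _ gcd≡1
               a b as a≉0 b≉0 as≉0 bound =
  DiagonalEquation.solvable F m gcd≡1 2≤q k n 5≤n a b as a≉0 b≉0 as≉0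
  where
  2≤q : 2 ≤ q
  2≤q = ℕ.≤-trans (ℕ.m≤m+n 2 482)
          (ℕ.≤-trans (ℕ.m≤m*n 484 _ {{ℕ.m^n≢0 (2 * m * k) (2 * n ∸ 2)}}) (ℕ.s≤s⁻¹ bound))
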